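{- (i) For every integer $n\ge 2$, $mon_2(K_n\Box K_n)=n$. (ii) Let $k$ be a positive integer and $t$ a positive even integer, and let $n=k\frac{t}{2}$. Then $mon_t(K_n\Box K_n)=k\frac{t^2}{4}$. (iii) With $k,t,n$ as in (ii), $mon_{2n-t}(K_n\Box K_n)=k(k-1)\frac{t^2}{4}$.
   Context: $K_n$ is the complete graph on $n$ vertices. The Cartesian product $G\Box H$ has vertex set $V(G)\times V(H)$, with $(u,v)$ adjacent to $(u',v')$ iff either $u=u'$ and $vv'\in E(H)$, or $v=v'$ and $uu'\in E(G)$. For a graph $G$ and constant threshold $t$ (at most every vertex degree), a set $M\subseteq V(G)$ is a $t$-monopoly if every vertex outside $M$ has at least $t$ neighbors in $M$; $mon_t(G)$ is the minimum size of a $t$-monopoly. -}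

module Defs where

open import Data.Nat using (ℕ; suc; _*_; _≤_)
open import Data.Fin using (Fin; remQuot)
open import Data.Fin.Subset using (Subset; _∈_; _∉_; ∣_∣; ⁅_⁆)
open import Data.Fin.Subset.Properties using (_∈?_)
open import Data.Product using (_×_; _,_; ∃)
open import Data.Sum using (_⊎_)
open import Data.List using (List; filter; length; allFin)
open import Relation.Nullary using (¬_; Dec; yes; no)
open import Relation.Nullary.Decidable using (_×-dec_; _⊎-dec_; ¬?)
open import Relation.Binary.PropositionalEquality using (_≡_)
import Data.Fin.Properties as FP

record Graph : Set₁ where
  field
    N     : ℕ
    Adj   : Fin N → Fin N → Set
    adj?  : ∀ u v → Dec (Adj u v)
open Graph public

K : ℕ → Graph
K n = record { N = n ; Adj = λ u v → ¬ (u ≡ v) ; adj? = λ u v → ¬? (u FP.≟ v) }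

-- Cartesian product G □ H; vertex set Fin (N G * N H) ≅ Fin (N G) × Fin (N H) via remQuot.
_□_ : Graph → Graph → Graph
G □ H = record
  { N = N G * N H
  ; Adj = λ x y → Ad (remQuot (N H) x) (remQuot (N H) y)
  ; adj? = λ x y → ad? (remQuot (N H) x) (remQuot (N H) y)
  }
  where
  Ad : Fin (N G) × Fin (N H) → Fin (N G) × Fin (N H) → Set
  Ad (u , v) (u' , v') = (u ≡ u' × Adj H v v') ⊎ (v ≡ v' × Adj G u u')
  ad? : ∀ p q → Dec (Ad p q)
  ad? (u , v) (u' , v') = ((u FP.≟ u') ×-dec adj? H v v') ⊎-dec ((v FP.≟ v') ×-dec adj? G u u')

nbrsIn : (G : Graph) → Subset (N G) → Fin (N G) → ℕ
nbrsIn G M v = length (filter (λ u → (u ∈? M) ×-dec adj? G u v) (allFin (N G)))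

IsMonopoly : (G : Graph) → ℕ → Subset (N G) → Set
IsMonopoly G t M = ∀ v → v ∉ M → t ≤ nbrsIn G M v

MonIs : (G : Graph) → ℕ → ℕ → Set
MonIs G t m = (∃ λ M → IsMonopoly G t M × ∣ M ∣ ≡ m)
            × (∀ M → IsMonopoly G t M → m ≤ ∣ M ∣)

module Submission where

-- View M ⊆ V(K n □ K n) as the 0/1 matrix of its vertices: a vertex (i , j) outside M has exactly
-- R i + C j neighbours in M (the members of M in its row and in its column), so M is a
-- 2r-monopoly iff R i + C j ≥ 2r at every absent entry.
-- Lower bound: let z i, w j count the absent entries of row i and column j, T their total and
-- d = n − r; then z i + w j ≤ 2d at every absent entry. Summing over the absent entries gives
-- Σ z² + Σ w² ≤ 2dT, while AM-GM gives Σ z² ≥ 2dT − nd² (and likewise for w), hence T ≤ nd,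
-- i.e. ∣M∣ ≥ nr.
-- Upper bound: a matrix all of whose line sums are r attains nr; take the block diagonal matrix
-- of h × h blocks of ones (r = h, and h = 1 for part (i)) or its complement (r = n − h).

open import Data.Bool.Base using (Bool; true; false; not; _∧_; _∨_)
open import Data.Bool.Properties using (not-injective)
open import Data.Fin.Base using (Fin; zero; suc; _↑ˡ_; _↑ʳ_; combine; remQuot)
open import Data.Fin.Properties using (_≟_; remQuot-combine; combine-remQuot)
open import Data.Fin.Subset using (Subset; _∉_; ∣_∣; inside; outside)
open import Data.Fin.Subset.Properties using (_∈?_)
open import Data.List.Base using (filter; length; tabulate)
open import Data.Nat.Base using (ℕ; zero; suc; _*_; _+_; _∸_; _≤_; z≤n; s≤s; >-nonZero)
open import Data.Nat.Properties hiding (_≟_)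
open import Algebra.Properties.Semiring.Sum +-*-semiring
  using (sum; sum-syntax; sum-cong-≗; ∑-distrib-+; ∑-comm; *-distribˡ-sum; *-distribʳ-sum)
open import Data.Nat.Solver using (module +-*-Solver)
open import Data.Product.Base using (_×_; _,_; proj₁; uncurry)
open import Data.Sum.Base using ([_,_]′)
open import Data.Vec.Base as Vec using ([]; _∷_; lookup)
open import Data.Vec.Properties using (lookup∘tabulate; []=⇒lookup)
open import Function.Base using (_∘_)
open import Relation.Binary.PropositionalEquality
open import Relation.Nullary.Decidable using (Dec; yes; no; does; dec-true; dec-false; _×-dec_)

open import Defs
open +-*-Solver

𝟙 : Bool → ℕ
𝟙 true  = 1
𝟙 false = 0

𝟙-not : ∀ b → 𝟙 (not b) + 𝟙 b ≡ 1
𝟙-not true  = refl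
𝟙-not false = refl

sum-const : ∀ n c → ∑[ i < n ] c ≡ n * c
sum-const zero    c = refl
sum-const (suc n) c = cong (c +_) (sum-const n c)

sum-mono-≤ : ∀ {n} {f g : Fin n → ℕ} → (∀ i → f i ≤ g i) → sum f ≤ sum g
sum-mono-≤ {zero}  f≤g = z≤n
sum-mono-≤ {suc n} f≤g = +-mono-≤ (f≤g zero) (sum-mono-≤ (f≤g ∘ suc))

sum-delta : ∀ {n} (i : Fin n) (g : Fin n → ℕ) → ∑[ j < n ] (𝟙 (does (j ≟ i)) * g j) ≡ g i
sum-delta {suc n} zero g = begin
  g zero + 0 + ∑[ j < n ] 0 ≡⟨ cong₂ _+_ (+-identityʳ (g zero)) (sum-const n 0) ⟩
  g zero + n * 0             ≡⟨ cong (g zero +_) (*-zeroʳ n) ⟩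
  g zero + 0                 ≡⟨ +-identityʳ (g zero) ⟩
  g zero                     ∎
  where open ≡-Reasoning
sum-delta {suc n} (suc i) g = trans (sum-cong-≗ does-suc) (sum-delta i (g ∘ suc))
  where
  does-suc : ∀ j → 𝟙 (does (suc j ≟ suc i)) * g (suc j) ≡ 𝟙 (does (j ≟ i)) * g (suc j)
  does-suc j with j ≟ i
  ... | yes _ = refl
  ... | no  _ = refl

sum-splitAt : ∀ m n (g : Fin (m + n) → ℕ) → sum g ≡ sum (g ∘ (_↑ˡ n)) + sum (g ∘ (m ↑ʳ_))
sum-splitAt zero    n g = refl
sum-splitAt (suc m) n g = trans (cong (g zero +_) (sum-splitAt m n (g ∘ suc))) (sym (+-assoc (g zero) _ _))

sum-combine : ∀ m n (g : Fin (m * n) → ℕ) → sum g ≡ ∑[ i < m ] ∑[ j < n ] g (combine i j)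
sum-combine zero    n g = refl
sum-combine (suc m) n g =
  trans (sum-splitAt n (m * n) g) (cong (sum (g ∘ (_↑ˡ m * n)) +_) (sum-combine m n (g ∘ (n ↑ʳ_))))

2*m*n≤m*m+n*n : ∀ m n → 2 * m * n ≤ m * m + n * n
2*m*n≤m*m+n*n m n = [ ordered , swapped ]′ (≤-total m n)
  where
  ordered : ∀ {a b} → a ≤ b → 2 * a * b ≤ a * a + b * b
  ordered {a} a≤b with m≤n⇒∃[o]m+o≡n a≤b
  ... | e , refl = begin
    2 * a * (a + e)           ≤⟨ m≤m+n _ (e * e) ⟩
    2 * a * (a + e) + e * e   ≡⟨ solve 2 (λ a e → con 2 :* a :* (a :+ e) :+ e :* e
                                               := a :* a :+ (a :+ e) :* (a :+ e)) refl a e ⟩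
    a * a + (a + e) * (a + e) ∎
    where open ≤-Reasoning
  swapped : n ≤ m → 2 * m * n ≤ m * m + n * n
  swapped n≤m = subst₂ _≤_ (solve 2 (λ m n → con 2 :* n :* m := con 2 :* m :* n) refl m n)
                           (+-comm (n * n) (m * m)) (ordered n≤m)

sum-amgm : ∀ {n} d (z : Fin n → ℕ) → 2 * d * sum z ≤ ∑[ i < n ] (z i * z i) + n * (d * d)
sum-amgm {n} d z = begin
  2 * d * sum z                           ≡⟨ *-distribˡ-sum (2 * d) z ⟩
  ∑[ i < n ] (2 * d * z i)                ≤⟨ sum-mono-≤ (λ i → 2*m*n≤m*m+n*n d (z i)) ⟩
  ∑[ i < n ] (d * d + z i * z i)          ≡⟨ ∑-distrib-+ (λ _ → d * d) (λ i → z i * z i) ⟩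
  ∑[ i < n ] (d * d) + ∑[ i < n ] (z i * z i) ≡⟨ cong (_+ ∑[ i < n ] (z i * z i)) (sum-const n (d * d)) ⟩
  n * (d * d) + ∑[ i < n ] (z i * z i)    ≡⟨ +-comm (n * (d * d)) _ ⟩
  ∑[ i < n ] (z i * z i) + n * (d * d)    ∎
  where open ≤-Reasoning

Matrix : ℕ → Set
Matrix n = Fin n → Fin n → Bool

∁ : ∀ {n} → Matrix n → Matrix n
∁ f i j = not (f i j)

module _ {n : ℕ} (f : Matrix n) where

  rowSum : Fin n → ℕ
  rowSum i = ∑[ j < n ] 𝟙 (f i j)

  colSum : Fin n → ℕ
  colSum j = ∑[ i < n ] 𝟙 (f i j)

  total : ℕ
  total = ∑[ i < n ] rowSum i

  total≡∑colSum : total ≡ ∑[ j < n ] colSum j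
  total≡∑colSum = ∑-comm (λ i j → 𝟙 (f i j))

  ∑𝟙*cross≡∑squares : ∑[ i < n ] ∑[ j < n ] (𝟙 (f i j) * (rowSum i + colSum j))
                     ≡ ∑[ i < n ] (rowSum i * rowSum i) + ∑[ j < n ] (colSum j * colSum j)
  ∑𝟙*cross≡∑squares = begin
    ∑[ i < n ] ∑[ j < n ] (𝟙 (f i j) * (rowSum i + colSum j))
      ≡⟨ sum-cong-≗ (λ i → trans (sum-cong-≗ (λ j → *-distribˡ-+ (𝟙 (f i j)) (rowSum i) (colSum j)))
                                 (∑-distrib-+ (λ j → 𝟙 (f i j) * rowSum i) (λ j → 𝟙 (f i j) * colSum j))) ⟩
    ∑[ i < n ] (∑[ j < n ] (𝟙 (f i j) * rowSum i) + ∑[ j < n ] (𝟙 (f i j) * colSum j))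
      ≡⟨ ∑-distrib-+ (λ i → ∑[ j < n ] (𝟙 (f i j) * rowSum i)) (λ i → ∑[ j < n ] (𝟙 (f i j) * colSum j)) ⟩
    ∑[ i < n ] ∑[ j < n ] (𝟙 (f i j) * rowSum i) + ∑[ i < n ] ∑[ j < n ] (𝟙 (f i j) * colSum j)
      ≡⟨ cong₂ _+_ (sum-cong-≗ λ i → sym (*-distribʳ-sum (rowSum i) (λ j → 𝟙 (f i j))))
                   (trans (∑-comm (λ i j → 𝟙 (f i j) * colSum j))
                          (sum-cong-≗ λ j → sym (*-distribʳ-sum (colSum j) (λ i → 𝟙 (f i j))))) ⟩
    ∑[ i < n ] (rowSum i * rowSum i) + ∑[ j < n ] (colSum j * colSum j) ∎
    where open ≡-Reasoning

  ∑squares≤total*2d : ∀ d → (∀ i j → f i j ≡ true → rowSum i + colSum j ≤ 2 * d) →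
                      ∑[ i < n ] (rowSum i * rowSum i) + ∑[ j < n ] (colSum j * colSum j) ≤ total * (2 * d)
  ∑squares≤total*2d d cross = begin
    ∑[ i < n ] (rowSum i * rowSum i) + ∑[ j < n ] (colSum j * colSum j)
      ≡⟨ ∑𝟙*cross≡∑squares ⟨
    ∑[ i < n ] ∑[ j < n ] (𝟙 (f i j) * (rowSum i + colSum j))
      ≤⟨ sum-mono-≤ (λ i → sum-mono-≤ (weighted i)) ⟩
    ∑[ i < n ] ∑[ j < n ] (𝟙 (f i j) * (2 * d))
      ≡⟨ sum-cong-≗ (λ i → *-distribʳ-sum (2 * d) (λ j → 𝟙 (f i j))) ⟨
    ∑[ i < n ] (rowSum i * (2 * d))
      ≡⟨ *-distribʳ-sum (2 * d) rowSum ⟨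
    total * (2 * d) ∎
    where
    open ≤-Reasoning
    weighted : ∀ i j → 𝟙 (f i j) * (rowSum i + colSum j) ≤ 𝟙 (f i j) * (2 * d)
    weighted i j with f i j in eq
    ... | true  = *-monoʳ-≤ 1 (cross i j eq)
    ... | false = z≤n

  total≤n*d : ∀ d → (∀ i j → f i j ≡ true → rowSum i + colSum j ≤ 2 * d) → total ≤ n * d
  total≤n*d zero cross = begin
    total                                     ≤⟨ sum-mono-≤ (λ i → m≤m*m (rowSum i)) ⟩
    ∑[ i < n ] (rowSum i * rowSum i)          ≤⟨ m≤m+n _ _ ⟩
    ∑[ i < n ] (rowSum i * rowSum i) + ∑[ j < n ] (colSum j * colSum j)
                                              ≤⟨ ∑squares≤total*2d 0 cross ⟩
    total * 0                                 ≡⟨ *-zeroʳ total ⟩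
    0                                         ≤⟨ z≤n ⟩
    n * 0                                     ∎
    where
    open ≤-Reasoning
    m≤m*m : ∀ m → m ≤ m * m
    m≤m*m zero    = z≤n
    m≤m*m (suc m) = m≤m*n (suc m) (suc m)
  total≤n*d d@(suc _) cross = *-cancelˡ-≤ d (*-cancelˡ-≤ 2 (subst₂ _≤_
      (solve 2 (λ d t → con 2 :* d :* t := con 2 :* (d :* t)) refl d total)
      (solve 2 (λ d n → con 2 :* (n :* (d :* d)) := con 2 :* (d :* (n :* d))) refl d n)
      (+-cancelˡ-≤ (2 * d * total) _ _ doubled)))
    where
    open ≤-Reasoning
    A = ∑[ i < n ] (rowSum i * rowSum i)
    B = ∑[ j < n ] (colSum j * colSum j)
    D = n * (d * d)
    doubled : 2 * d * total + 2 * d * total ≤ 2 * d * total + 2 * D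
    doubled = begin
      2 * d * total + 2 * d * total
        ≤⟨ +-mono-≤ (sum-amgm d rowSum) (subst (λ t → 2 * d * t ≤ B + D) (sym total≡∑colSum) (sum-amgm d colSum)) ⟩
      (A + D) + (B + D)       ≡⟨ solve 3 (λ a b e → (a :+ e) :+ (b :+ e) := (a :+ b) :+ con 2 :* e) refl A B D ⟩
      (A + B) + 2 * D         ≤⟨ +-monoˡ-≤ (2 * D) (∑squares≤total*2d d cross) ⟩
      total * (2 * d) + 2 * D ≡⟨ cong (_+ 2 * D) (*-comm total (2 * d)) ⟩
      2 * d * total + 2 * D   ∎

sum-𝟙-not : ∀ {n} (b : Fin n → Bool) → ∑[ i < n ] 𝟙 (not (b i)) + ∑[ i < n ] 𝟙 (b i) ≡ n
sum-𝟙-not {n} b = begin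
  ∑[ i < n ] 𝟙 (not (b i)) + ∑[ i < n ] 𝟙 (b i) ≡⟨ ∑-distrib-+ (𝟙 ∘ not ∘ b) (𝟙 ∘ b) ⟨
  ∑[ i < n ] (𝟙 (not (b i)) + 𝟙 (b i))         ≡⟨ sum-cong-≗ (𝟙-not ∘ b) ⟩
  ∑[ i < n ] 1                                  ≡⟨ sum-const n 1 ⟩
  n * 1                                         ≡⟨ *-identityʳ n ⟩
  n                                             ∎
  where open ≡-Reasoning

total-∁ : ∀ {n} (f : Matrix n) → total (∁ f) + total f ≡ n * n
total-∁ {n} f = begin
  total (∁ f) + total f                          ≡⟨ ∑-distrib-+ (rowSum (∁ f)) (rowSum f) ⟨
  ∑[ i < n ] (rowSum (∁ f) i + rowSum f i)      ≡⟨ sum-cong-≗ (λ i → sum-𝟙-not (f i)) ⟩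
  ∑[ i < n ] n                                  ≡⟨ sum-const n n ⟩
  n * n                                         ∎
  where open ≡-Reasoning

n*r≤total : ∀ {n} (f : Matrix n) r d → r + d ≡ n →
            (∀ i j → f i j ≡ false → 2 * r ≤ rowSum f i + colSum f j) → n * r ≤ total f
n*r≤total {n} f r d r+d≡n cross = +-cancelʳ-≤ (n * d) _ _ (begin
  n * r + n * d           ≡⟨ *-distribˡ-+ n r d ⟨
  n * (r + d)             ≡⟨ cong (n *_) r+d≡n ⟩
  n * n                   ≡⟨ total-∁ f ⟨
  total (∁ f) + total f   ≡⟨ +-comm (total (∁ f)) (total f) ⟩
  total f + total (∁ f)   ≤⟨ +-monoʳ-≤ (total f) (total≤n*d (∁ f) d cross-∁) ⟩
  total f + n * d         ∎)
  where
  open ≤-Reasoning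
  cross-∁ : ∀ i j → not (f i j) ≡ true → rowSum (∁ f) i + colSum (∁ f) j ≤ 2 * d
  cross-∁ i j absent = +-cancelʳ-≤ (2 * r) _ _ (begin
    (R′ + C′) + 2 * r                 ≤⟨ +-monoʳ-≤ (R′ + C′) (cross i j (not-injective absent)) ⟩
    (R′ + C′) + (rowSum f i + colSum f j)
      ≡⟨ solve 4 (λ a b c e → (a :+ b) :+ (c :+ e) := (a :+ c) :+ (b :+ e)) refl R′ C′ (rowSum f i) (colSum f j) ⟩
    (R′ + rowSum f i) + (C′ + colSum f j)
      ≡⟨ cong₂ _+_ (sum-𝟙-not (f i)) (sum-𝟙-not (λ i′ → f i′ j)) ⟩
    n + n                             ≡⟨ cong (λ m → m + m) r+d≡n ⟨
    (r + d) + (r + d)                 ≡⟨ solve 2 (λ r d → (r :+ d) :+ (r :+ d) := con 2 :* d :+ con 2 :* r) refl r d ⟩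
    2 * d + 2 * r                     ∎)
    where
    R′ = rowSum (∁ f) i
    C′ = colSum (∁ f) j

length-filter-tabulate : ∀ {p} {A : Set} {P : A → Set p} (P? : ∀ x → Dec (P x)) {n} (f : Fin n → A) →
                         length (filter P? (tabulate f)) ≡ ∑[ i < n ] 𝟙 (does (P? (f i)))
length-filter-tabulate P? {zero}  f = refl
length-filter-tabulate P? {suc n} f with does (P? (f zero))
... | true  = cong suc (length-filter-tabulate P? (f ∘ suc))
... | false = length-filter-tabulate P? (f ∘ suc)

does-∈? : ∀ {n} (x : Fin n) (p : Subset n) → does (x ∈? p) ≡ lookup p x
does-∈? zero    (inside  ∷ p) = refl
does-∈? zero    (outside ∷ p) = refl
does-∈? (suc x) (_ ∷ p)       = does-∈? x p

∣p∣≡∑lookup : ∀ {n} (p : Subset n) → ∣ p ∣ ≡ ∑[ x < n ] 𝟙 (lookup p x)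
∣p∣≡∑lookup []            = refl
∣p∣≡∑lookup (inside  ∷ p) = cong suc (∣p∣≡∑lookup p)
∣p∣≡∑lookup (outside ∷ p) = ∣p∣≡∑lookup p

-- a: membership of (i′ , j′) in M; p, q: whether i′ = i, j′ = j. The hypothesis excludes (i , j) itself.
𝟙-adjacent-member : ∀ a p q → (p ≡ true → q ≡ true → a ≡ false) →
                    𝟙 (a ∧ (p ∧ not q ∨ q ∧ not p)) ≡ 𝟙 p * 𝟙 a + 𝟙 q * 𝟙 a
𝟙-adjacent-member true  true  true  excluded with () ← excluded refl refl
𝟙-adjacent-member true  true  false _ = refl
𝟙-adjacent-member true  false true  _ = refl
𝟙-adjacent-member true  false false _ = refl
𝟙-adjacent-member false true  true  _ = refl
𝟙-adjacent-member false true  false _ = refl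
𝟙-adjacent-member false false true  _ = refl
𝟙-adjacent-member false false false _ = refl

module _ {n : ℕ} where

  membership : Subset (n * n) → Matrix n
  membership M i j = lookup M (combine i j)

  does-adj?-combine : ∀ i′ j′ i j → does (adj? (K n □ K n) (combine i′ j′) (combine i j))
                      ≡ does (i′ ≟ i) ∧ not (does (j′ ≟ j)) ∨ does (j′ ≟ j) ∧ not (does (i′ ≟ i))
  does-adj?-combine i′ j′ i j = cong₂ adjacentᵇ (remQuot-combine i′ j′) (remQuot-combine i j)
    where
    adjacentᵇ : Fin n × Fin n → Fin n × Fin n → Bool
    adjacentᵇ (u , v) (u′ , v′) = does (u ≟ u′) ∧ not (does (v ≟ v′)) ∨ does (v ≟ v′) ∧ not (does (u ≟ u′))

  ∣M∣≡total : ∀ M → ∣ M ∣ ≡ total (membership M)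
  ∣M∣≡total M = trans (∣p∣≡∑lookup M) (sum-combine n n (𝟙 ∘ lookup M))

  nbrsIn≡rowSum+colSum : ∀ M i j → membership M i j ≡ false →
                         nbrsIn (K n □ K n) M (combine i j) ≡ rowSum (membership M) i + colSum (membership M) j
  nbrsIn≡rowSum+colSum M i j absent = begin
    nbrsIn (K n □ K n) M (combine i j)
      ≡⟨ length-filter-tabulate (λ u → (u ∈? M) ×-dec adj? (K n □ K n) u (combine i j)) (λ u → u) ⟩
    ∑[ u < n * n ] 𝟙 (does (u ∈? M) ∧ does (adj? (K n □ K n) u (combine i j)))
      ≡⟨ sum-combine n n _ ⟩
    ∑[ i′ < n ] ∑[ j′ < n ] 𝟙 (does (combine i′ j′ ∈? M) ∧ does (adj? (K n □ K n) (combine i′ j′) (combine i j)))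
      ≡⟨ sum-cong-≗ (λ i′ → sum-cong-≗ (λ j′ → neighbour i′ j′)) ⟩
    ∑[ i′ < n ] ∑[ j′ < n ] (δ i′ i * e i′ j′ + δ j′ j * e i′ j′)
      ≡⟨ sum-cong-≗ (λ i′ → ∑-distrib-+ (λ j′ → δ i′ i * e i′ j′) (λ j′ → δ j′ j * e i′ j′)) ⟩
    ∑[ i′ < n ] (∑[ j′ < n ] (δ i′ i * e i′ j′) + ∑[ j′ < n ] (δ j′ j * e i′ j′))
      ≡⟨ ∑-distrib-+ (λ i′ → ∑[ j′ < n ] (δ i′ i * e i′ j′)) (λ i′ → ∑[ j′ < n ] (δ j′ j * e i′ j′)) ⟩
    ∑[ i′ < n ] ∑[ j′ < n ] (δ i′ i * e i′ j′) + ∑[ i′ < n ] ∑[ j′ < n ] (δ j′ j * e i′ j′)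
      ≡⟨ cong₂ _+_ (sum-cong-≗ (λ i′ → sym (*-distribˡ-sum (δ i′ i) (e i′))))
                   (sum-cong-≗ (λ i′ → sum-delta j (e i′))) ⟩
    ∑[ i′ < n ] (δ i′ i * rowSum (membership M) i′) + colSum (membership M) j
      ≡⟨ cong (_+ colSum (membership M) j) (sum-delta i (rowSum (membership M))) ⟩
    rowSum (membership M) i + colSum (membership M) j ∎
    where
    open ≡-Reasoning
    δ : Fin n → Fin n → ℕ
    δ a b = 𝟙 (does (a ≟ b))
    e : Fin n → Fin n → ℕ
    e i′ j′ = 𝟙 (membership M i′ j′)
    not-both : ∀ i′ j′ → does (i′ ≟ i) ≡ true → does (j′ ≟ j) ≡ true → membership M i′ j′ ≡ false
    not-both i′ j′ with i′ ≟ i | j′ ≟ j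
    ... | yes refl | yes refl = λ _ _ → absent
    ... | yes _    | no _     = λ _ ()
    ... | no _     | _        = λ ()
    neighbour : ∀ i′ j′ → 𝟙 (does (combine i′ j′ ∈? M) ∧ does (adj? (K n □ K n) (combine i′ j′) (combine i j)))
                        ≡ δ i′ i * e i′ j′ + δ j′ j * e i′ j′
    neighbour i′ j′ rewrite does-∈? (combine i′ j′) M | does-adj?-combine i′ j′ i j =
      𝟙-adjacent-member (membership M i′ j′) (does (i′ ≟ i)) (does (j′ ≟ j)) (not-both i′ j′)

  ∉⇒lookup≡false : ∀ {x} {M : Subset (n * n)} → x ∉ M → lookup M x ≡ false
  ∉⇒lookup≡false {x} {M} x∉M = trans (sym (does-∈? x M)) (dec-false (x ∈? M) x∉M)

  lookup≡false⇒∉ : ∀ {x} {M : Subset (n * n)} → lookup M x ≡ false → x ∉ M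
  lookup≡false⇒∉ absent x∈M with () ← trans (sym ([]=⇒lookup x∈M)) absent

  monopoly⇒cross : ∀ {t M} → IsMonopoly (K n □ K n) t M →
                   ∀ i j → membership M i j ≡ false → t ≤ rowSum (membership M) i + colSum (membership M) j
  monopoly⇒cross {t} {M} mono i j absent =
    subst (t ≤_) (nbrsIn≡rowSum+colSum M i j absent) (mono (combine i j) (lookup≡false⇒∉ absent))

  cross⇒monopoly : ∀ {t M} →
                   (∀ i j → membership M i j ≡ false → t ≤ rowSum (membership M) i + colSum (membership M) j) →
                   IsMonopoly (K n □ K n) t M
  cross⇒monopoly {t} {M} cross v v∉M = at (remQuot {n} n v) (combine-remQuot {n} n v) v∉M
    where
    at : ∀ {x} ((i , j) : Fin n × Fin n) → combine i j ≡ x → x ∉ M → t ≤ nbrsIn (K n □ K n) M x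
    at (i , j) refl x∉M = subst (t ≤_) (sym (nbrsIn≡rowSum+colSum M i j absent)) (cross i j absent)
      where absent = ∉⇒lookup≡false x∉M

  monopoly-size : ∀ {r M} → r ≤ n → IsMonopoly (K n □ K n) (2 * r) M → n * r ≤ ∣ M ∣
  monopoly-size {r} {M} r≤n mono = subst (n * r ≤_) (sym (∣M∣≡total M))
    (n*r≤total (membership M) r (n ∸ r) (m+[n∸m]≡n r≤n) (monopoly⇒cross mono))

  fromMatrix : Matrix n → Subset (n * n)
  fromMatrix f = Vec.tabulate (uncurry f ∘ remQuot n)

  membership-fromMatrix : ∀ f i j → membership (fromMatrix f) i j ≡ f i j
  membership-fromMatrix f i j =
    trans (lookup∘tabulate (uncurry f ∘ remQuot n) (combine i j)) (cong (uncurry f) (remQuot-combine i j))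

  monIs-regular : ∀ {r} → r ≤ n → (f : Matrix n) → (∀ i → rowSum f i ≡ r) → (∀ j → colSum f j ≡ r) →
                  MonIs (K n □ K n) (2 * r) (n * r)
  monIs-regular {r} r≤n f rows cols =
    (fromMatrix f , cross⇒monopoly cross , size) , λ _ → monopoly-size r≤n
    where
    open ≡-Reasoning
    entries = membership-fromMatrix f
    cross : ∀ i j → membership (fromMatrix f) i j ≡ false →
            2 * r ≤ rowSum (membership (fromMatrix f)) i + colSum (membership (fromMatrix f)) j
    cross i j _ = ≤-reflexive (begin
      2 * r                     ≡⟨ cong (r +_) (+-identityʳ r) ⟩
      r + r                     ≡⟨ cong₂ _+_ (rows i) (cols j) ⟨
      rowSum f i + colSum f j   ≡⟨ cong₂ _+_ (sum-cong-≗ (λ j′ → cong 𝟙 (entries i j′)))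
                                             (sum-cong-≗ (λ i′ → cong 𝟙 (entries i′ j))) ⟨
      rowSum (membership (fromMatrix f)) i + colSum (membership (fromMatrix f)) j ∎)
    size : ∣ fromMatrix f ∣ ≡ n * r
    size = begin
      ∣ fromMatrix f ∣                    ≡⟨ ∣M∣≡total (fromMatrix f) ⟩
      total (membership (fromMatrix f))   ≡⟨ sum-cong-≗ (λ i → sum-cong-≗ (λ j → cong 𝟙 (entries i j))) ⟩
      total f                             ≡⟨ sum-cong-≗ rows ⟩
      ∑[ i < n ] r                        ≡⟨ sum-const n r ⟩
      n * r                               ∎

rowSum-∁ : ∀ {n} (f : Matrix n) i → rowSum (∁ f) i ≡ n ∸ rowSum f i
rowSum-∁ f i = trans (sym (m+n∸n≡m _ (rowSum f i))) (cong (_∸ rowSum f i) (sum-𝟙-not (f i)))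

colSum-∁ : ∀ {n} (f : Matrix n) j → colSum (∁ f) j ≡ n ∸ colSum f j
colSum-∁ f j = trans (sym (m+n∸n≡m _ (colSum f j))) (cong (_∸ colSum f j) (sum-𝟙-not (λ i → f i j)))

does-≟-sym : ∀ {k} (a b : Fin k) → does (a ≟ b) ≡ does (b ≟ a)
does-≟-sym a b with a ≟ b
... | yes refl = sym (dec-true (a ≟ a) refl)
... | no  a≢b  = sym (dec-false (b ≟ a) (a≢b ∘ sym))

module _ (k h : ℕ) where

  block : Fin (k * h) → Fin k
  block = proj₁ ∘ remQuot h

  sameBlock : Matrix (k * h)
  sameBlock i j = does (block j ≟ block i)

  ∑-inBlock : ∀ p → ∑[ j < k * h ] 𝟙 (does (block j ≟ p)) ≡ h
  ∑-inBlock p = begin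
    ∑[ j < k * h ] 𝟙 (does (block j ≟ p))
      ≡⟨ sum-combine k h (λ j → 𝟙 (does (block j ≟ p))) ⟩
    ∑[ p′ < k ] ∑[ q < h ] 𝟙 (does (block (combine p′ q) ≟ p))
      ≡⟨ sum-cong-≗ (λ p′ → sum-cong-≗ (λ q → cong (λ b → 𝟙 (does (b ≟ p))) (cong proj₁ (remQuot-combine {k} {h} p′ q)))) ⟩
    ∑[ p′ < k ] ∑[ q < h ] 𝟙 (does (p′ ≟ p))
      ≡⟨ sum-cong-≗ (λ p′ → trans (sum-const h (𝟙 (does (p′ ≟ p)))) (*-comm h (𝟙 (does (p′ ≟ p))))) ⟩
    ∑[ p′ < k ] (𝟙 (does (p′ ≟ p)) * h)
      ≡⟨ sum-delta p (λ _ → h) ⟩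
    h ∎
    where open ≡-Reasoning

  rowSum-sameBlock : ∀ i → rowSum sameBlock i ≡ h
  rowSum-sameBlock i = ∑-inBlock (block i)

  colSum-sameBlock : ∀ j → colSum sameBlock j ≡ h
  colSum-sameBlock j = trans (sum-cong-≗ (λ i → cong 𝟙 (does-≟-sym (block j) (block i)))) (∑-inBlock (block j))

  monIs-sameBlock : 1 ≤ k → MonIs (K (k * h) □ K (k * h)) (2 * h) (k * (h * h))
  monIs-sameBlock 1≤k = subst (MonIs (K (k * h) □ K (k * h)) (2 * h)) (*-assoc k h h)
    (monIs-regular (m≤n*m h k ⦃ >-nonZero 1≤k ⦄) sameBlock rowSum-sameBlock colSum-sameBlock)

  monIs-∁sameBlock : MonIs (K (k * h) □ K (k * h)) (2 * (k * h) ∸ 2 * h) (k * (k ∸ 1) * (h * h))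
  monIs-∁sameBlock = subst₂ (MonIs (K (k * h) □ K (k * h))) (*-distribˡ-∸ 2 (k * h) h) size
    (monIs-regular (m∸n≤m (k * h) h) (∁ sameBlock)
      (λ i → trans (rowSum-∁ sameBlock i) (cong (k * h ∸_) (rowSum-sameBlock i)))
      (λ j → trans (colSum-∁ sameBlock j) (cong (k * h ∸_) (colSum-sameBlock j))))
    where
    kh∸h : k * h ∸ h ≡ (k ∸ 1) * h
    kh∸h = trans (cong (k * h ∸_) (sym (*-identityˡ h))) (sym (*-distribʳ-∸ h k 1))
    size : k * h * (k * h ∸ h) ≡ k * (k ∸ 1) * (h * h)
    size = trans (cong (k * h *_) kh∸h)
                 (solve 3 (λ k k′ h → k :* h :* (k′ :* h) := k :* k′ :* (h :* h)) refl k (k ∸ 1) h)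

theorem3 : (∀ (n : ℕ) → 2 ≤ n → MonIs (K n □ K n) 2 n)
         × (∀ (k h : ℕ) → 1 ≤ k → 1 ≤ h →
             MonIs (K (k * h) □ K (k * h)) (2 * h) (k * (h * h)))
         × (∀ (k h : ℕ) → 1 ≤ k → 1 ≤ h →
             MonIs (K (k * h) □ K (k * h)) (2 * (k * h) ∸ 2 * h) (k * (k ∸ 1) * (h * h)))
theorem3 = diagonal , (λ k h 1≤k _ → monIs-sameBlock k h 1≤k) , (λ k h _ _ → monIs-∁sameBlock k h)
  where
  diagonal : ∀ n → 2 ≤ n → MonIs (K n □ K n) 2 n
  diagonal n 2≤n = subst (λ m → MonIs (K m □ K m) 2 m) (*-identityʳ n) (monIs-sameBlock n 1 (≤-trans (s≤s z≤n) 2≤n))
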